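{- Let $S_{2/9} = \{(0,0),(1,0)\} + 3\mathbb{Z}^2$. Then $S_{2/9}$ is a maximal B-stable set, a maximal I-stable set, and a maximal BI-stable set.
   Context: A lattice triangle is the convex hull in $\mathbb{R}^2$ of three non-collinear points of $\mathbb{Z}^2$. A triangle is a set $T = \Delta \cap \mathbb{Z}^2$ for a lattice triangle $\Delta$. A triangle is minimal if it contains exactly $4$ points of $\mathbb{Z}^2$; a minimal triangle is a border triangle if its non-vertex point lies on the boundary of $\Delta$, and an internal triangle if that point lies in the interior of $\Delta$. A set $S \subseteq \mathbb{Z}^2$ is B-stable if no border triangle has exactly three of its points in $S$; I-stable if no internal triangle has exactly three of its points in $S$; BI-stable if both. A maximal B-stable (resp. I-stable, BI-stable) set is a B-stable (resp. I-stable, BI-stable) proper subset $S \subsetneq \mathbb{Z}^2$ such that no B-stable (resp. I-stable, BI-stable) proper subset of $\mathbb{Z}^2$ properly contains $S$. -}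

module Defs where

open import Data.Integer using (ℤ; _+_; _-_; _*_; _≤_; _<_; +_; 0ℤ)
open import Data.Integer.Divisibility using (_∣_)
open import Data.Product using (_×_; Σ; ∃; _,_)
open import Data.Sum using (_⊎_)
open import Relation.Nullary using (¬_)
open import Relation.Binary.PropositionalEquality using (_≡_)

Point : Set
Point = ℤ × ℤ

Subset : Set₁
Subset = Point → Set

-- det (q - p, r - p): twice the signed area of (p, q, r).
orient : Point → Point → Point → ℤ
orient (px , py) (qx , qy) (rx , ry) = (qx - px) * (ry - py) - (qy - py) * (rx - px)

NonCollinear : Point → Point → Point → Set
NonCollinear a b c = ¬ (orient a b c ≡ 0ℤ)

-- p lies in the closed lattice triangle conv{a,b,c} (a,b,c non-collinear):
-- p is weakly on the same side of each edge as the opposite vertex.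
InHull : Point → Point → Point → Point → Set
InHull a b c p =
  (0ℤ ≤ orient a b c * orient a b p) ×
  (0ℤ ≤ orient a b c * orient b c p) ×
  (0ℤ ≤ orient a b c * orient c a p)

InInterior : Point → Point → Point → Point → Set
InInterior a b c p =
  (0ℤ < orient a b c * orient a b p) ×
  (0ℤ < orient a b c * orient b c p) ×
  (0ℤ < orient a b c * orient c a p)

-- The triangle T = conv{a,b,c} ∩ ℤ² is minimal with non-vertex point d:
-- T = {a, b, c, d} has exactly 4 points.
MinimalWith : Point → Point → Point → Point → Set
MinimalWith a b c d =
  NonCollinear a b c ×
  InHull a b c d ×
  ¬ (d ≡ a) × ¬ (d ≡ b) × ¬ (d ≡ c) ×
  (∀ p → InHull a b c p → (p ≡ a) ⊎ (p ≡ b) ⊎ (p ≡ c) ⊎ (p ≡ d))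

Border : Point → Point → Point → Point → Set
Border a b c d = MinimalWith a b c d × ¬ InInterior a b c d

Internal : Point → Point → Point → Point → Set
Internal a b c d = MinimalWith a b c d × InInterior a b c d

ExactlyThree : Subset → Point → Point → Point → Point → Set
ExactlyThree S a b c d =
  (¬ S a × S b × S c × S d) ⊎
  (S a × ¬ S b × S c × S d) ⊎
  (S a × S b × ¬ S c × S d) ⊎
  (S a × S b × S c × ¬ S d)

BStable : Subset → Set
BStable S = ∀ a b c d → Border a b c d → ¬ ExactlyThree S a b c d

IStable : Subset → Set
IStable S = ∀ a b c d → Internal a b c d → ¬ ExactlyThree S a b c d

BIStable : Subset → Set
BIStable S = BStable S × IStable S

_⊆_ : Subset → Subset → Set
S ⊆ S' = ∀ p → S p → S' p

Proper : Subset → Set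
Proper S = ∃ λ q → ¬ S q

Maximal : (Subset → Set) → Subset → Set₁
Maximal P S =
  P S × Proper S ×
  (∀ S' → P S' → Proper S' → S ⊆ S' → ¬ (∃ λ p → S' p × ¬ S p))

S29 : Subset
S29 (x , y) = ((+ 3 ∣ x) ⊎ (+ 3 ∣ (x - + 1))) × (+ 3 ∣ y)

module Submission where

-- The four points of a minimal triangle are pairwise incongruent modulo 3: if two of them were congruent,
-- the two lattice points trisecting the segment between them, together with a vertex off that segment,
-- would put five lattice points in the triangle. Since S29 meets only two residue classes, it contains at
-- most two points of any minimal triangle, so it is B- and I-stable.
-- For maximality, unimodular affine maps preserve border and internal triangles, and the shears
-- (x , y) ↦ (x + m y + 3s , ±y + 3t) preserve S29 and carry (2 , 0) or (0 , 1) to any point outside S29.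
-- Starting from either of these two points, a finite certificate of applications of stability to images of
-- one fixed border (resp. internal) triangle forces a stable superset of S29 to contain the block [0,2]²
-- and the four translates of the point by ±3e; translating the certificate then fills all of ℤ².

open import Defs
open import Data.Bool.Base using (Bool; true; T; _∧_; _∨_)
open import Data.Bool.ListAction using (all)
open import Data.Bool.Properties using (T-∧; T-∨)
open import Data.Empty using (⊥; ⊥-elim)
open import Data.Fin.Base using (Fin; suc; toℕ)
open import Data.Fin.Patterns using (0F; 1F; 2F; 3F)
import Data.Fin.Properties as Fin
open import Data.Integer.Base using (ℤ; +_; -[1+_]; -_; _+_; _-_; _*_; _⊖_; ∣_∣; 0ℤ; 1ℤ; -1ℤ; _≤_; _<_; +≤+; +<+; ≢-nonZero)
open import Data.Integer.DivMod using (_%ℕ_; _/ℕ_; n%ℕd<d; a≡a%ℕn+[a/ℕn]*n)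
open import Data.Integer.Divisibility using (_∣_)
import Data.Integer.Divisibility.Signed as Signed
open import Data.Integer.Properties
  using (_≟_; +-injective; +-identityʳ; *-identityˡ; *-zeroʳ; *-assoc; *-comm; abs-*; pos-+; pos-*; m-n≡m⊖n; ⊖-≥;
         0≤i⇒+∣i∣≡i; i-j≡0⇒i≡j; i*j≡0⇒i≡0∨j≡0; *-cancelˡ-≡; *-cancelʳ-≡; *-cancelˡ-≤-pos)
open import Data.Integer.Tactic.RingSolver using (solve-∀)
open import Data.List.Base using (List; []; _∷_; map; _++_; upTo; cartesianProductWith)
open import Data.List.Membership.Propositional using (_∈_)
open import Data.List.Membership.Propositional.Properties using (∈-cartesianProductWith⁺; ∈-upTo⁺)
open import Data.List.Relation.Unary.All as All using (All; []; _∷_)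
import Data.List.Relation.Unary.All.Properties as All
open import Data.List.Relation.Unary.Any using (here; there)
open import Data.Nat.Base as ℕ using (ℕ)
import Data.Nat.Divisibility as ℕ
import Data.Nat.Properties as ℕ
open import Data.Product.Base using (_×_; _,_; ∃; proj₁; proj₂)
open import Data.Product.Properties using (≡-dec)
open import Data.Sum.Base as Sum using (_⊎_; inj₁; inj₂)
open import Effect.Monad using (RawMonad)
open import Function.Base using (_∘_)
open import Function.Bundles using (Equivalence)
open import Level using (0ℓ)
open import Relation.Binary.PropositionalEquality
open import Relation.Nullary.Decidable
  using (Dec; isYes; yes; no; False; toWitness; toWitnessFalse; _⊎-dec_; _×-dec_)
open import Relation.Nullary.Negation using (¬_; ¬¬-Monad)

open import Data.List.Membership.DecPropositional (≡-dec {B = λ _ → ℤ} _≟_ _≟_) using (_∈?_)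
open RawMonad (¬¬-Monad {a = 0ℓ}) using (pure; _>>=_)

-- Unimodular affine maps

infixl 6 _⊕_
infixr 7 _⊛_

_⊕_ : Point → Point → Point
(x , y) ⊕ (x′ , y′) = (x + x′ , y + y′)

_⊛_ : ℤ → Point → Point
k ⊛ (x , y) = (k * x , k * y)

record Affine : Set where
  constructor affine
  field m₁₁ m₁₂ m₂₁ m₂₂ t₁ t₂ : ℤ

apply : Affine → Point → Point
apply (affine a b c d s t) (x , y) = (a * x + b * y + s , c * x + d * y + t)

det : Affine → ℤ
det (affine a b c d _ _) = a * d - b * c

record Unimodular (φ : Affine) : Set where
  constructor unimodular
  field det² : det φ * det φ ≡ 1ℤ

-- Since det φ is its own inverse, the inverse map is det φ times the adjugate.
unapply : Affine → Point → Point
unapply φ@(affine a b c d s t) (x , y) =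
  (det φ * (d * (x - s) - b * (y - t)) , det φ * (a * (y - t) - c * (x - s)))

unimodular-scale : ∀ {φ} → Unimodular φ → ∀ z r → det φ * det φ * (z - r) + r ≡ z
unimodular-scale {φ} u z r = begin
  det φ * det φ * (z - r) + r ≡⟨ cong (λ e → e * (z - r) + r) (Unimodular.det² u) ⟩
  1ℤ * (z - r) + r            ≡⟨ cancel z r ⟩
  z                           ∎
  where
  open ≡-Reasoning
  cancel : ∀ z r → 1ℤ * (z - r) + r ≡ z
  cancel = solve-∀

apply-unapply : ∀ {φ} → Unimodular φ → ∀ p → apply φ (unapply φ p) ≡ p
apply-unapply {φ@(affine a b c d s t)} u (x , y) =
  cong₂ _,_ (trans (first a b c d s t x y) (unimodular-scale u x s))
            (trans (second a b c d s t x y) (unimodular-scale u y t))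
  where
  first : ∀ a b c d s t x y →
    a * ((a * d - b * c) * (d * (x - s) - b * (y - t))) + b * ((a * d - b * c) * (a * (y - t) - c * (x - s))) + s
      ≡ (a * d - b * c) * (a * d - b * c) * (x - s) + s
  first = solve-∀
  second : ∀ a b c d s t x y →
    c * ((a * d - b * c) * (d * (x - s) - b * (y - t))) + d * ((a * d - b * c) * (a * (y - t) - c * (x - s))) + t
      ≡ (a * d - b * c) * (a * d - b * c) * (y - t) + t
  second = solve-∀

unapply-apply : ∀ {φ} → Unimodular φ → ∀ p → unapply φ (apply φ p) ≡ p
unapply-apply {φ@(affine a b c d s t)} u (x , y) =
  cong₂ _,_ (trans (first a b c d s t x y) (unimodular-scale u x 0ℤ))
            (trans (second a b c d s t x y) (unimodular-scale u y 0ℤ))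
  where
  first : ∀ a b c d s t x y →
    (a * d - b * c) * (d * ((a * x + b * y + s) - s) - b * ((c * x + d * y + t) - t))
      ≡ (a * d - b * c) * (a * d - b * c) * (x - 0ℤ) + 0ℤ
  first = solve-∀
  second : ∀ a b c d s t x y →
    (a * d - b * c) * (a * ((c * x + d * y + t) - t) - c * ((a * x + b * y + s) - s))
      ≡ (a * d - b * c) * (a * d - b * c) * (y - 0ℤ) + 0ℤ
  second = solve-∀

apply-injective : ∀ {φ} → Unimodular φ → ∀ {p q} → apply φ p ≡ apply φ q → p ≡ q
apply-injective {φ} u {p} {q} eq = begin
  p                     ≡⟨ unapply-apply u p ⟨
  unapply φ (apply φ p) ≡⟨ cong (unapply φ) eq ⟩
  unapply φ (apply φ q) ≡⟨ unapply-apply u q ⟩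
  q                     ∎
  where open ≡-Reasoning

orient-apply : ∀ φ a b c → orient (apply φ a) (apply φ b) (apply φ c) ≡ det φ * orient a b c
orient-apply (affine m₁₁ m₁₂ m₂₁ m₂₂ s t) (ax , ay) (bx , by) (cx , cy) =
  identity m₁₁ m₁₂ m₂₁ m₂₂ s t ax ay bx by cx cy
  where
  identity : ∀ m₁₁ m₁₂ m₂₁ m₂₂ s t ax ay bx by cx cy →
    ((m₁₁ * bx + m₁₂ * by + s) - (m₁₁ * ax + m₁₂ * ay + s)) * ((m₂₁ * cx + m₂₂ * cy + t) - (m₂₁ * ax + m₂₂ * ay + t))
      - ((m₂₁ * bx + m₂₂ * by + t) - (m₂₁ * ax + m₂₂ * ay + t)) * ((m₁₁ * cx + m₁₂ * cy + s) - (m₁₁ * ax + m₁₂ * ay + s))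
      ≡ (m₁₁ * m₂₂ - m₁₂ * m₂₁) * ((bx - ax) * (cy - ay) - (by - ay) * (cx - ax))
  identity = solve-∀

-- A unimodular map may reverse orientation, but it preserves the sign comparisons in InHull.
orient-sign-apply : ∀ {φ} → Unimodular φ → ∀ a b c p q r →
  orient (apply φ a) (apply φ b) (apply φ c) * orient (apply φ p) (apply φ q) (apply φ r)
    ≡ orient a b c * orient p q r
orient-sign-apply {φ} u a b c p q r = begin
  orient (apply φ a) (apply φ b) (apply φ c) * orient (apply φ p) (apply φ q) (apply φ r)
    ≡⟨ cong₂ _*_ (orient-apply φ a b c) (orient-apply φ p q r) ⟩
  det φ * orient a b c * (det φ * orient p q r)
    ≡⟨ regroup (det φ) (orient a b c) (orient p q r) ⟩
  det φ * det φ * (orient a b c * orient p q r)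
    ≡⟨ cong (_* (orient a b c * orient p q r)) (Unimodular.det² u) ⟩
  1ℤ * (orient a b c * orient p q r)
    ≡⟨ *-identityˡ _ ⟩
  orient a b c * orient p q r
    ∎
  where
  open ≡-Reasoning
  regroup : ∀ δ x y → δ * x * (δ * y) ≡ δ * δ * (x * y)
  regroup = solve-∀

module _ {φ : Affine} (u : Unimodular φ) {a b c : Point} where

  private
    φ′ = apply φ
    sign = orient-sign-apply u a b c

  InHull-apply : ∀ {p} → InHull a b c p → InHull (φ′ a) (φ′ b) (φ′ c) (φ′ p)
  InHull-apply {p} (h₁ , h₂ , h₃) =
    subst (0ℤ ≤_) (sym (sign a b p)) h₁ ,
    subst (0ℤ ≤_) (sym (sign b c p)) h₂ ,
    subst (0ℤ ≤_) (sym (sign c a p)) h₃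

  InHull-unapply : ∀ {p} → InHull (φ′ a) (φ′ b) (φ′ c) (φ′ p) → InHull a b c p
  InHull-unapply {p} (h₁ , h₂ , h₃) =
    subst (0ℤ ≤_) (sign a b p) h₁ , subst (0ℤ ≤_) (sign b c p) h₂ , subst (0ℤ ≤_) (sign c a p) h₃

  InInterior-apply : ∀ {p} → InInterior a b c p → InInterior (φ′ a) (φ′ b) (φ′ c) (φ′ p)
  InInterior-apply {p} (h₁ , h₂ , h₃) =
    subst (0ℤ <_) (sym (sign a b p)) h₁ ,
    subst (0ℤ <_) (sym (sign b c p)) h₂ ,
    subst (0ℤ <_) (sym (sign c a p)) h₃

  InInterior-unapply : ∀ {p} → InInterior (φ′ a) (φ′ b) (φ′ c) (φ′ p) → InInterior a b c p
  InInterior-unapply {p} (h₁ , h₂ , h₃) =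
    subst (0ℤ <_) (sign a b p) h₁ , subst (0ℤ <_) (sign b c p) h₂ , subst (0ℤ <_) (sign c a p) h₃

  NonCollinear-apply : NonCollinear a b c → NonCollinear (φ′ a) (φ′ b) (φ′ c)
  NonCollinear-apply nc collinear = nc (begin
    orient a b c                       ≡⟨ *-identityˡ _ ⟨
    1ℤ * orient a b c                  ≡⟨ cong (_* orient a b c) (Unimodular.det² u) ⟨
    det φ * det φ * orient a b c       ≡⟨ *-assoc (det φ) (det φ) _ ⟩
    det φ * (det φ * orient a b c)     ≡⟨ cong (det φ *_) (orient-apply φ a b c) ⟨
    det φ * orient (φ′ a) (φ′ b) (φ′ c) ≡⟨ cong (det φ *_) collinear ⟩
    det φ * 0ℤ                         ≡⟨ *-zeroʳ (det φ) ⟩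
    0ℤ                                 ∎)
    where open ≡-Reasoning

  MinimalWith-apply : ∀ {d} → MinimalWith a b c d → MinimalWith (φ′ a) (φ′ b) (φ′ c) (φ′ d)
  MinimalWith-apply {d} (nc , d∈ , d≢a , d≢b , d≢c , only) =
    NonCollinear-apply nc , InHull-apply d∈ ,
    d≢a ∘ apply-injective u , d≢b ∘ apply-injective u , d≢c ∘ apply-injective u ,
    λ p p∈ → Sum.map (image p) (Sum.map (image p) (Sum.map (image p) (image p)))
      (only (unapply φ p) (InHull-unapply (subst (InHull (φ′ a) (φ′ b) (φ′ c)) (sym (apply-unapply u p)) p∈)))
    where
    image : ∀ p {x} → unapply φ p ≡ x → p ≡ φ′ x
    image p eq = trans (sym (apply-unapply u p)) (cong φ′ eq)

  Border-apply : ∀ {d} → Border a b c d → Border (φ′ a) (φ′ b) (φ′ c) (φ′ d)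
  Border-apply (minimal , not-interior) = MinimalWith-apply minimal , not-interior ∘ InInterior-unapply

  Internal-apply : ∀ {d} → Internal a b c d → Internal (φ′ a) (φ′ b) (φ′ c) (φ′ d)
  Internal-apply (minimal , interior) = MinimalWith-apply minimal , InInterior-apply interior

PullbackClosed : (Subset → Set) → Set₁
PullbackClosed St = ∀ {φ S} → Unimodular φ → St S → St (S ∘ apply φ)

BStable-pullback : PullbackClosed BStable
BStable-pullback u stable a b c d border = stable _ _ _ _ (Border-apply u border)

IStable-pullback : PullbackClosed IStable
IStable-pullback u stable a b c d internal = stable _ _ _ _ (Internal-apply u internal)

BIStable-pullback : PullbackClosed BIStable
BIStable-pullback u (b-stable , i-stable) = BStable-pullback u b-stable , IStable-pullback u i-stable

-- The corners of a minimal triangle are incongruent modulo 3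

orient-repeat₁ : ∀ x y → orient x x y ≡ 0ℤ
orient-repeat₁ (xx , xy) (yx , yy) = identity xx xy yx yy
  where
  identity : ∀ xx xy yx yy → (xx - xx) * (yy - xy) - (xy - xy) * (yx - xx) ≡ 0ℤ
  identity = solve-∀

orient-repeat₂ : ∀ x y → orient x y x ≡ 0ℤ
orient-repeat₂ (xx , xy) (yx , yy) = identity xx xy yx yy
  where
  identity : ∀ xx xy yx yy → (yx - xx) * (xy - xy) - (yy - xy) * (xx - xx) ≡ 0ℤ
  identity = solve-∀

orient-repeat₃ : ∀ x y → orient x y y ≡ 0ℤ
orient-repeat₃ (xx , xy) (yx , yy) = identity xx xy yx yy
  where
  identity : ∀ xx xy yx yy → (yx - xx) * (yy - xy) - (yy - xy) * (yx - xx) ≡ 0ℤ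
  identity = solve-∀

orient-rotate : ∀ a b c → orient b c a ≡ orient a b c
orient-rotate (ax , ay) (bx , by) (cx , cy) = identity ax ay bx by cx cy
  where
  identity : ∀ ax ay bx by cx cy →
    (cx - bx) * (ay - by) - (cy - by) * (ax - bx) ≡ (bx - ax) * (cy - ay) - (by - ay) * (cx - ax)
  identity = solve-∀

-- Each coordinate of orient a b c ⊛ (v - u) is a combination of orient u v a, orient u v b and orient u v c.
collinear-on-line : ∀ {u v a b c} → u ≢ v →
  orient u v a ≡ 0ℤ → orient u v b ≡ 0ℤ → orient u v c ≡ 0ℤ → orient a b c ≡ 0ℤ
collinear-on-line {ux , uy} {vx , vy} {ax , ay} {bx , by} {cx , cy} u≢v ua ub uc
  with orient (ax , ay) (bx , by) (cx , cy) ≟ 0ℤ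
... | yes collinear = collinear
... | no D≢0 = ⊥-elim (u≢v (cong₂ _,_ (sym (same vx ux x-identity)) (sym (same vy uy y-identity))))
  where
  D = orient (ax , ay) (bx , by) (cx , cy)
  x-identity : D * (vx - ux) ≡ 0ℤ
  x-identity = begin
    D * (vx - ux)
      ≡⟨ first ux uy vx vy ax ay bx by cx cy ⟨
    orient (ux , uy) (vx , vy) (ax , ay) * (cx - bx) + orient (ux , uy) (vx , vy) (bx , by) * (ax - cx)
      + orient (ux , uy) (vx , vy) (cx , cy) * (bx - ax)
      ≡⟨ cong₂ _+_ (cong₂ _+_ (cong (_* (cx - bx)) ua) (cong (_* (ax - cx)) ub)) (cong (_* (bx - ax)) uc) ⟩
    0ℤ ∎
    where
    open ≡-Reasoning
    first : ∀ ux uy vx vy ax ay bx by cx cy →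
      ((vx - ux) * (ay - uy) - (vy - uy) * (ax - ux)) * (cx - bx) + ((vx - ux) * (by - uy) - (vy - uy) * (bx - ux)) * (ax - cx)
        + ((vx - ux) * (cy - uy) - (vy - uy) * (cx - ux)) * (bx - ax)
        ≡ ((bx - ax) * (cy - ay) - (by - ay) * (cx - ax)) * (vx - ux)
    first = solve-∀
  y-identity : D * (vy - uy) ≡ 0ℤ
  y-identity = begin
    D * (vy - uy)
      ≡⟨ second ux uy vx vy ax ay bx by cx cy ⟨
    orient (ux , uy) (vx , vy) (ax , ay) * (cy - by) + orient (ux , uy) (vx , vy) (bx , by) * (ay - cy)
      + orient (ux , uy) (vx , vy) (cx , cy) * (by - ay)
      ≡⟨ cong₂ _+_ (cong₂ _+_ (cong (_* (cy - by)) ua) (cong (_* (ay - cy)) ub)) (cong (_* (by - ay)) uc) ⟩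
    0ℤ ∎
    where
    open ≡-Reasoning
    second : ∀ ux uy vx vy ax ay bx by cx cy →
      ((vx - ux) * (ay - uy) - (vy - uy) * (ax - ux)) * (cy - by) + ((vx - ux) * (by - uy) - (vy - uy) * (bx - ux)) * (ay - cy)
        + ((vx - ux) * (cy - uy) - (vy - uy) * (cx - ux)) * (by - ay)
        ≡ ((bx - ax) * (cy - ay) - (by - ay) * (cx - ax)) * (vy - uy)
    second = solve-∀
  same : ∀ s t → D * (s - t) ≡ 0ℤ → s ≡ t
  same s t eq = i-j≡0⇒i≡j s t (Sum.[ (λ D≡0 → ⊥-elim (D≢0 D≡0)) , (λ diff≡0 → diff≡0) ] (i*j≡0⇒i≡0∨j≡0 D eq))

segment-nonneg : ∀ {k X Y Z} → k ℕ.≤ 3 → 0ℤ ≤ X → 0ℤ ≤ Y → + 3 * Z ≡ (+ 3 - + k) * X + + k * Y → 0ℤ ≤ Z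
segment-nonneg {k} {Z = Z} k≤3 (+≤+ {n = x} _) (+≤+ {n = y} _) eq =
  *-cancelˡ-≤-pos 0ℤ Z (+ 3) (subst (0ℤ ≤_) (sym natural-weights) (+≤+ ℕ.z≤n))
  where
  natural-weights : + 3 * Z ≡ + ((3 ℕ.∸ k) ℕ.* x ℕ.+ k ℕ.* y)
  natural-weights = begin
    + 3 * Z                                   ≡⟨ eq ⟩
    (+ 3 - + k) * + x + + k * + y             ≡⟨ cong (λ m → m * + x + + k * + y) (m-n≡m⊖n 3 k) ⟩
    (3 ⊖ k) * + x + + k * + y                 ≡⟨ cong (λ m → m * + x + + k * + y) (⊖-≥ k≤3) ⟩
    + (3 ℕ.∸ k) * + x + + k * + y             ≡⟨ cong₂ _+_ (pos-* (3 ℕ.∸ k) x) (pos-* k y) ⟨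
    + ((3 ℕ.∸ k) ℕ.* x) + + (k ℕ.* y)         ≡⟨ pos-+ ((3 ℕ.∸ k) ℕ.* x) (k ℕ.* y) ⟨
    + ((3 ℕ.∸ k) ℕ.* x ℕ.+ k ℕ.* y)           ∎
    where open ≡-Reasoning

orient-segment : ∀ D e₁ e₂ u w k →
  + 3 * (D * orient e₁ e₂ (u ⊕ k ⊛ w)) ≡ (+ 3 - k) * (D * orient e₁ e₂ u) + k * (D * orient e₁ e₂ (u ⊕ + 3 ⊛ w))
orient-segment D (ax , ay) (bx , by) (ux , uy) (wx , wy) k = identity D ax ay bx by ux uy wx wy k
  where
  identity : ∀ D ax ay bx by ux uy wx wy k →
    + 3 * (D * ((bx - ax) * ((uy + k * wy) - ay) - (by - ay) * ((ux + k * wx) - ax)))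
      ≡ (+ 3 - k) * (D * ((bx - ax) * (uy - ay) - (by - ay) * (ux - ax)))
        + k * (D * ((bx - ax) * ((uy + + 3 * wy) - ay) - (by - ay) * ((ux + + 3 * wx) - ax)))
  identity = solve-∀

InHull-segment : ∀ {a b c u w k} → k ℕ.≤ 3 →
  InHull a b c u → InHull a b c (u ⊕ + 3 ⊛ w) → InHull a b c (u ⊕ + k ⊛ w)
InHull-segment {a} {b} {c} {u} {w} {k} k≤3 (h₁ , h₂ , h₃) (g₁ , g₂ , g₃) = edge a b h₁ g₁ , edge b c h₂ g₂ , edge c a h₃ g₃
  where
  edge : ∀ e₁ e₂ → 0ℤ ≤ orient a b c * orient e₁ e₂ u → 0ℤ ≤ orient a b c * orient e₁ e₂ (u ⊕ + 3 ⊛ w) →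
    0ℤ ≤ orient a b c * orient e₁ e₂ (u ⊕ + k ⊛ w)
  edge e₁ e₂ h g = segment-nonneg k≤3 h g (orient-segment (orient a b c) e₁ e₂ u w (+ k))

orient-on-segment : ∀ u w k → orient u (u ⊕ + 3 ⊛ w) (u ⊕ k ⊛ w) ≡ 0ℤ
orient-on-segment (ux , uy) (wx , wy) k = identity ux uy wx wy k
  where
  identity : ∀ ux uy wx wy k → ((ux + + 3 * wx) - ux) * ((uy + k * wy) - uy) - ((uy + + 3 * wy) - uy) * ((ux + k * wx) - ux) ≡ 0ℤ
  identity = solve-∀

⊕-identityʳ : ∀ u → u ⊕ (0ℤ , 0ℤ) ≡ u
⊕-identityʳ (x , y) = cong₂ _,_ (+-identityʳ x) (+-identityʳ y)

⊕-cancelˡ : ∀ u {p q} → u ⊕ p ≡ u ⊕ q → p ≡ q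
⊕-cancelˡ (ux , uy) {px , py} {qx , qy} eq =
  cong₂ _,_ (cancel ux px qx (cong proj₁ eq)) (cancel uy py qy (cong proj₂ eq))
  where
  cancel : ∀ u p q → u + p ≡ u + q → p ≡ q
  cancel u p q eq = trans (sym (difference u p)) (trans (cong (_- u) eq) (difference u q))
    where
    difference : ∀ u p → (u + p) - u ≡ p
    difference = solve-∀

⊛-cancelʳ : ∀ {w} → w ≢ (0ℤ , 0ℤ) → ∀ {k l} → k ⊛ w ≡ l ⊛ w → k ≡ l
⊛-cancelʳ {wx , wy} w≢0 {k} {l} eq with wx ≟ 0ℤ | wy ≟ 0ℤ
... | no wx≢0 | _ = *-cancelʳ-≡ k l wx {{≢-nonZero wx≢0}} (cong proj₁ eq)
... | yes _ | no wy≢0 = *-cancelʳ-≡ k l wy {{≢-nonZero wy≢0}} (cong proj₂ eq)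
... | yes wx≡0 | yes wy≡0 = ⊥-elim (w≢0 (cong₂ _,_ wx≡0 wy≡0))

square-nonneg : ∀ i → 0ℤ ≤ i * i
square-nonneg (+ n) = subst (0ℤ ≤_) (pos-* n n) (+≤+ ℕ.z≤n)
square-nonneg -[1+ n ] = +≤+ ℕ.z≤n

record Congruent (p q : Point) : Set where
  constructor congruent-by
  field
    offset : Point
    shifted : q ≡ p ⊕ + 3 ⊛ offset

congruent : ∀ x y x′ y′ → + 3 Signed.∣ (x′ - x) → + 3 Signed.∣ (y′ - y) → Congruent (x , y) (x′ , y′)
congruent x y x′ y′ (Signed.divides k dx) (Signed.divides l dy) = congruent-by (k , l) (cong₂ _,_ (shift x x′ k dx) (shift y y′ l dy))
  where
  shift : ∀ z z′ k → z′ - z ≡ k * + 3 → z′ ≡ z + + 3 * k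
  shift z z′ k eq = begin
    z′              ≡⟨ recombine z z′ ⟩
    z + (z′ - z)    ≡⟨ cong (λ e → z + e) eq ⟩
    z + k * + 3     ≡⟨ cong (λ e → z + e) (*-comm k (+ 3)) ⟩
    z + + 3 * k     ∎
    where
    open ≡-Reasoning
    recombine : ∀ z z′ → z′ ≡ z + (z′ - z)
    recombine = solve-∀

same-class₀ : ∀ x x′ → + 3 ∣ x → + 3 ∣ x′ → + 3 Signed.∣ (x′ - x)
same-class₀ x x′ 3∣x 3∣x′ = Signed.∣m∣n⇒∣m-n {m = x′} {n = x} (Signed.∣ᵤ⇒∣ {i = x′} 3∣x′) (Signed.∣ᵤ⇒∣ {i = x} 3∣x)

same-class₁ : ∀ x x′ → + 3 ∣ (x - + 1) → + 3 ∣ (x′ - + 1) → + 3 Signed.∣ (x′ - x)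
same-class₁ x x′ 3∣x-1 3∣x′-1 = subst (+ 3 Signed.∣_) (shift-cancels x x′) (same-class₀ (x - + 1) (x′ - + 1) 3∣x-1 3∣x′-1)
  where
  shift-cancels : ∀ x x′ → (x′ - + 1) - (x - + 1) ≡ x′ - x
  shift-cancels = solve-∀

-- S29 meets only two residue classes modulo 3.
S29-pigeonhole : ∀ p q r → S29 p → S29 q → S29 r → Congruent p q ⊎ Congruent p r ⊎ Congruent q r
S29-pigeonhole (x₁ , y₁) (x₂ , y₂) (x₃ , y₃) = cases
  where
  pair₀ : ∀ {x y x′ y′} → + 3 ∣ x → + 3 ∣ y → + 3 ∣ x′ → + 3 ∣ y′ → Congruent (x , y) (x′ , y′)
  pair₀ {x} {y} {x′} {y′} hx hy hx′ hy′ = congruent x y x′ y′ (same-class₀ x x′ hx hx′) (same-class₀ y y′ hy hy′)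
  pair₁ : ∀ {x y x′ y′} → + 3 ∣ (x - + 1) → + 3 ∣ y → + 3 ∣ (x′ - + 1) → + 3 ∣ y′ → Congruent (x , y) (x′ , y′)
  pair₁ {x} {y} {x′} {y′} hx hy hx′ hy′ = congruent x y x′ y′ (same-class₁ x x′ hx hx′) (same-class₀ y y′ hy hy′)
  cases : S29 (x₁ , y₁) → S29 (x₂ , y₂) → S29 (x₃ , y₃) →
    Congruent (x₁ , y₁) (x₂ , y₂) ⊎ Congruent (x₁ , y₁) (x₃ , y₃) ⊎ Congruent (x₂ , y₂) (x₃ , y₃)
  cases (inj₁ h₁ , k₁) (inj₁ h₂ , k₂) _ = inj₁ (pair₀ h₁ k₁ h₂ k₂)
  cases (inj₂ h₁ , k₁) (inj₂ h₂ , k₂) _ = inj₁ (pair₁ h₁ k₁ h₂ k₂)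
  cases (inj₁ h₁ , k₁) (inj₂ _ , _) (inj₁ h₃ , k₃) = inj₂ (inj₁ (pair₀ h₁ k₁ h₃ k₃))
  cases (inj₂ h₁ , k₁) (inj₁ _ , _) (inj₂ h₃ , k₃) = inj₂ (inj₁ (pair₁ h₁ k₁ h₃ k₃))
  cases (inj₁ _ , _) (inj₂ h₂ , k₂) (inj₂ h₃ , k₃) = inj₂ (inj₂ (pair₁ h₂ k₂ h₃ k₃))
  cases (inj₂ _ , _) (inj₁ h₂ , k₂) (inj₁ h₃ , k₃) = inj₂ (inj₂ (pair₀ h₂ k₂ h₃ k₃))

corners : Point → Point → Point → Point → Fin 4 → Point
corners a b c d 0F = a
corners a b c d 1F = b
corners a b c d 2F = c
corners a b c d 3F = d

module MinimalTriangle {a b c d : Point} (minimal : MinimalWith a b c d) where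

  private
    D = orient a b c
    nc = proj₁ minimal
    d∈ = proj₁ (proj₂ minimal)
    d≢a = proj₁ (proj₂ (proj₂ minimal))
    d≢b = proj₁ (proj₂ (proj₂ (proj₂ minimal)))
    d≢c = proj₁ (proj₂ (proj₂ (proj₂ (proj₂ minimal))))
    only = proj₂ (proj₂ (proj₂ (proj₂ (proj₂ minimal))))

  corner : Fin 4 → Point
  corner = corners a b c d

  private
    on-edge : ∀ {z} → z ≡ 0ℤ → 0ℤ ≤ D * z
    on-edge refl = subst (0ℤ ≤_) (sym (*-zeroʳ D)) (+≤+ ℕ.z≤n)

    opposite : ∀ {z} → z ≡ D → 0ℤ ≤ D * z
    opposite refl = square-nonneg D

  corner-InHull : ∀ k → InHull a b c (corner k)
  corner-InHull 0F = on-edge (orient-repeat₂ a b) , opposite (orient-rotate a b c) , on-edge (orient-repeat₃ c a)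
  corner-InHull 1F = on-edge (orient-repeat₃ a b) , on-edge (orient-repeat₂ b c) , opposite (sym (orient-rotate c a b))
  corner-InHull 2F = opposite refl , on-edge (orient-repeat₃ b c) , on-edge (orient-repeat₂ c a)
  corner-InHull 3F = d∈

  InHull⇒corner : ∀ {p} → InHull a b c p → ∃ λ k → p ≡ corner k
  InHull⇒corner {p} p∈ with only p p∈
  ... | inj₁ p≡a = 0F , p≡a
  ... | inj₂ (inj₁ p≡b) = 1F , p≡b
  ... | inj₂ (inj₂ (inj₁ p≡c)) = 2F , p≡c
  ... | inj₂ (inj₂ (inj₂ p≡d)) = 3F , p≡d

  private
    a≢b : a ≢ b
    a≢b a≡b = nc (trans (cong (λ x → orient a x c) (sym a≡b)) (orient-repeat₁ a c))
    a≢c : a ≢ c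
    a≢c a≡c = nc (trans (cong (orient a b) (sym a≡c)) (orient-repeat₂ a b))
    b≢c : b ≢ c
    b≢c b≡c = nc (trans (cong (orient a b) (sym b≡c)) (orient-repeat₃ a b))

  corner-injective : ∀ i j → corner i ≡ corner j → i ≡ j
  corner-injective 0F 0F _ = refl
  corner-injective 0F 1F eq = ⊥-elim (a≢b eq)
  corner-injective 0F 2F eq = ⊥-elim (a≢c eq)
  corner-injective 0F 3F eq = ⊥-elim (d≢a (sym eq))
  corner-injective 1F 0F eq = ⊥-elim (a≢b (sym eq))
  corner-injective 1F 1F _ = refl
  corner-injective 1F 2F eq = ⊥-elim (b≢c eq)
  corner-injective 1F 3F eq = ⊥-elim (d≢b (sym eq))
  corner-injective 2F 0F eq = ⊥-elim (a≢c (sym eq))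
  corner-injective 2F 1F eq = ⊥-elim (b≢c (sym eq))
  corner-injective 2F 2F _ = refl
  corner-injective 2F 3F eq = ⊥-elim (d≢c (sym eq))
  corner-injective 3F 0F eq = ⊥-elim (d≢a eq)
  corner-injective 3F 1F eq = ⊥-elim (d≢b eq)
  corner-injective 3F 2F eq = ⊥-elim (d≢c eq)
  corner-injective 3F 3F _ = refl

  no-five-points : (f : Fin 5 → Point) → (∀ t → InHull a b c (f t)) → ¬ (∀ s t → f s ≡ f t → s ≡ t)
  no-five-points f f∈ f-injective = Fin.<⇒≢ s<t (f-injective s t (begin
    f s                     ≡⟨ proj₂ (index s) ⟩
    corner (proj₁ (index s)) ≡⟨ cong corner same-index ⟩
    corner (proj₁ (index t)) ≡⟨ proj₂ (index t) ⟨
    f t                     ∎))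
    where
    open ≡-Reasoning
    index : ∀ t → ∃ λ k → f t ≡ corner k
    index t = InHull⇒corner (f∈ t)
    collision = Fin.pigeonhole (ℕ.n<1+n 4) (proj₁ ∘ index)
    s = proj₁ collision
    t = proj₁ (proj₂ collision)
    s<t = proj₁ (proj₂ (proj₂ collision))
    same-index = proj₂ (proj₂ (proj₂ collision))

  off-line : ∀ {u v} → u ≢ v → ∃ λ k → orient u v (corner k) ≢ 0ℤ
  off-line {u} {v} u≢v with orient u v a ≟ 0ℤ | orient u v b ≟ 0ℤ | orient u v c ≟ 0ℤ
  ... | no ua≢0 | _ | _ = 0F , ua≢0
  ... | yes _ | no ub≢0 | _ = 1F , ub≢0
  ... | yes _ | yes _ | no uc≢0 = 2F , uc≢0
  ... | yes ua | yes ub | yes uc = ⊥-elim (nc (collinear-on-line {u} {v} {a} {b} {c} u≢v ua ub uc))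

  corners-incongruent : ∀ {i j} w → i ≢ j → corner j ≢ corner i ⊕ + 3 ⊛ w
  corners-incongruent {i} {j} w i≢j v≡ = no-five-points five five-InHull five-injective
    where
    u = corner i
    v = corner j
    u≢v : u ≢ v
    u≢v u≡v = i≢j (corner-injective i j u≡v)
    w≢0 : w ≢ (0ℤ , 0ℤ)
    w≢0 refl = u≢v (sym (trans v≡ (⊕-identityʳ u)))
    point : Fin 4 → Point
    point k = u ⊕ + toℕ k ⊛ w
    on-line : ∀ k → orient u v (point k) ≡ 0ℤ
    on-line k = trans (cong (λ v → orient u v (point k)) v≡) (orient-on-segment u w (+ toℕ k))
    off = off-line u≢v
    five : Fin 5 → Point
    five 0F = corner (proj₁ off)
    five (suc k) = point k
    five-InHull : ∀ t → InHull a b c (five t)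
    five-InHull 0F = corner-InHull (proj₁ off)
    five-InHull (suc k) = InHull-segment {a} {b} {c} {u} {w} (Fin.toℕ≤pred[n] k)
      (corner-InHull i) (subst (InHull a b c) v≡ (corner-InHull j))
    five-injective : ∀ s t → five s ≡ five t → s ≡ t
    five-injective 0F 0F _ = refl
    five-injective 0F (suc k) eq = ⊥-elim (proj₂ off (trans (cong (orient u v) eq) (on-line k)))
    five-injective (suc k) 0F eq = ⊥-elim (proj₂ off (trans (cong (orient u v) (sym eq)) (on-line k)))
    five-injective (suc k) (suc l) eq = cong suc (Fin.toℕ-injective (+-injective (⊛-cancelʳ w≢0 (⊕-cancelˡ u eq))))

  no-three : ∀ i j k → i ≢ j → i ≢ k → j ≢ k → S29 (corner i) → S29 (corner j) → S29 (corner k) → ⊥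
  no-three i j k i≢j i≢k j≢k si sj sk with S29-pigeonhole (corner i) (corner j) (corner k) si sj sk
  ... | inj₁ (congruent-by w eq) = corners-incongruent w i≢j eq
  ... | inj₂ (inj₁ (congruent-by w eq)) = corners-incongruent w i≢k eq
  ... | inj₂ (inj₂ (congruent-by w eq)) = corners-incongruent w j≢k eq

S29-avoids-minimal : ∀ {a b c d} → MinimalWith a b c d → ¬ ExactlyThree S29 a b c d
S29-avoids-minimal minimal (inj₁ (_ , sb , sc , sd)) = no-three 1F 2F 3F (λ ()) (λ ()) (λ ()) sb sc sd
  where open MinimalTriangle minimal
S29-avoids-minimal minimal (inj₂ (inj₁ (sa , _ , sc , sd))) = no-three 0F 2F 3F (λ ()) (λ ()) (λ ()) sa sc sd
  where open MinimalTriangle minimal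
S29-avoids-minimal minimal (inj₂ (inj₂ (inj₁ (sa , sb , _ , sd)))) = no-three 0F 1F 3F (λ ()) (λ ()) (λ ()) sa sb sd
  where open MinimalTriangle minimal
S29-avoids-minimal minimal (inj₂ (inj₂ (inj₂ (sa , sb , sc , _)))) = no-three 0F 1F 2F (λ ()) (λ ()) (λ ()) sa sb sc
  where open MinimalTriangle minimal

S29-BStable : BStable S29
S29-BStable _ _ _ _ (minimal , _) = S29-avoids-minimal minimal

S29-IStable : IStable S29
S29-IStable _ _ _ _ (minimal , _) = S29-avoids-minimal minimal

-- Two template minimal triangles

record Barycentric (a b c p : Point) (n : ℕ) : Set where
  constructor barycentric
  field
    α β γ : ℕ
    total : α ℕ.+ β ℕ.+ γ ≡ n
    position : + n ⊛ p ≡ + α ⊛ a ⊕ + β ⊛ b ⊕ + γ ⊛ c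

orient-sum : ∀ a b c p → orient b c p + orient c a p + orient a b p ≡ orient a b c
orient-sum (ax , ay) (bx , by) (cx , cy) (px , py) = identity ax ay bx by cx cy px py
  where
  identity : ∀ ax ay bx by cx cy px py →
    ((cx - bx) * (py - by) - (cy - by) * (px - bx)) + ((ax - cx) * (py - cy) - (ay - cy) * (px - cx))
      + ((bx - ax) * (py - ay) - (by - ay) * (px - ax))
      ≡ (bx - ax) * (cy - ay) - (by - ay) * (cx - ax)
  identity = solve-∀

orient-combination : ∀ a b c p → orient a b c ⊛ p ≡ orient b c p ⊛ a ⊕ orient c a p ⊛ b ⊕ orient a b p ⊛ c
orient-combination (ax , ay) (bx , by) (cx , cy) (px , py) =
  cong₂ _,_ (first ax ay bx by cx cy px py) (second ax ay bx by cx cy px py)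
  where
  first : ∀ ax ay bx by cx cy px py →
    ((bx - ax) * (cy - ay) - (by - ay) * (cx - ax)) * px
      ≡ ((cx - bx) * (py - by) - (cy - by) * (px - bx)) * ax + ((ax - cx) * (py - cy) - (ay - cy) * (px - cx)) * bx
        + ((bx - ax) * (py - ay) - (by - ay) * (px - ax)) * cx
  first = solve-∀
  second : ∀ ax ay bx by cx cy px py →
    ((bx - ax) * (cy - ay) - (by - ay) * (cx - ax)) * py
      ≡ ((cx - bx) * (py - by) - (cy - by) * (px - bx)) * ay + ((ax - cx) * (py - cy) - (ay - cy) * (px - cx)) * by
        + ((bx - ax) * (py - ay) - (by - ay) * (px - ax)) * cy
  second = solve-∀

-- For a positively oriented triangle the three edge orientations of p are its barycentric weights.
hull-barycentric : ∀ {a b c p m} → orient a b c ≡ + ℕ.suc m → InHull a b c p → Barycentric a b c p (ℕ.suc m)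
hull-barycentric {a} {b} {c} {p} {m} positive (h₁ , h₂ , h₃) =
  barycentric (∣ orient b c p ∣) (∣ orient c a p ∣) (∣ orient a b p ∣) total position
  where
  n = ℕ.suc m
  weight : ∀ {z} → 0ℤ ≤ orient a b c * z → + ∣ z ∣ ≡ z
  weight {z} h = 0≤i⇒+∣i∣≡i (*-cancelˡ-≤-pos 0ℤ z (+ n)
    (subst (_≤ + n * z) (sym (*-zeroʳ (+ n))) (subst (λ D → 0ℤ ≤ D * z) positive h)))
  wa = weight h₂
  wb = weight h₃
  wc = weight h₁
  total : ∣ orient b c p ∣ ℕ.+ ∣ orient c a p ∣ ℕ.+ ∣ orient a b p ∣ ≡ n
  total = +-injective (begin
    + (∣ orient b c p ∣ ℕ.+ ∣ orient c a p ∣ ℕ.+ ∣ orient a b p ∣)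
      ≡⟨ trans (pos-+ _ ∣ orient a b p ∣) (cong (_+ + ∣ orient a b p ∣) (pos-+ ∣ orient b c p ∣ ∣ orient c a p ∣)) ⟩
    + ∣ orient b c p ∣ + + ∣ orient c a p ∣ + + ∣ orient a b p ∣
      ≡⟨ cong₂ _+_ (cong₂ _+_ wa wb) wc ⟩
    orient b c p + orient c a p + orient a b p
      ≡⟨ orient-sum a b c p ⟩
    orient a b c
      ≡⟨ positive ⟩
    + n ∎)
    where open ≡-Reasoning
  position : + n ⊛ p ≡ + ∣ orient b c p ∣ ⊛ a ⊕ + ∣ orient c a p ∣ ⊛ b ⊕ + ∣ orient a b p ∣ ⊛ c
  position = begin
    + n ⊛ p                    ≡⟨ cong (_⊛ p) positive ⟨
    orient a b c ⊛ p           ≡⟨ orient-combination a b c p ⟩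
    orient b c p ⊛ a ⊕ orient c a p ⊛ b ⊕ orient a b p ⊛ c
      ≡⟨ cong₂ _⊕_ (cong₂ _⊕_ (cong (_⊛ a) wa) (cong (_⊛ b) wb)) (cong (_⊛ c) wc) ⟨
    + ∣ orient b c p ∣ ⊛ a ⊕ + ∣ orient c a p ∣ ⊛ b ⊕ + ∣ orient a b p ∣ ⊛ c
      ∎
    where open ≡-Reasoning

⊛-cancelˡ : ∀ m {p q} → + ℕ.suc m ⊛ p ≡ + ℕ.suc m ⊛ q → p ≡ q
⊛-cancelˡ m {px , py} {qx , qy} eq =
  cong₂ _,_ (*-cancelˡ-≡ (+ ℕ.suc m) px qx (cong proj₁ eq)) (*-cancelˡ-≡ (+ ℕ.suc m) py qy (cong proj₂ eq))

multiple-divides : ∀ k x r → + k * x ≡ + r → k ℕ.∣ r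
multiple-divides k x r eq = ℕ.divides ∣ x ∣ (begin
  r               ≡⟨ cong ∣_∣ eq ⟨
  ∣ + k * x ∣     ≡⟨ abs-* (+ k) x ⟩
  k ℕ.* ∣ x ∣     ≡⟨ ℕ.*-comm k ∣ x ∣ ⟩
  ∣ x ∣ ℕ.* k     ∎)
  where open ≡-Reasoning

indivisible : ∀ k x r → {False (k ℕ.∣? r)} → + k * x ≢ + r
indivisible k x r {k∤r} eq = toWitnessFalse k∤r (multiple-divides k x r eq)

a₀ b₀ c₀ d₀ : Point
a₀ = (+ 0 , + 0)
b₀ = (+ 2 , + 0)
c₀ = (+ 0 , + 1)
d₀ = (+ 1 , + 0)

border₀-points : ∀ {p} → Barycentric a₀ b₀ c₀ p 2 → (p ≡ a₀) ⊎ (p ≡ b₀) ⊎ (p ≡ c₀) ⊎ (p ≡ d₀)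
border₀-points (barycentric 0 0 _ refl position) = inj₂ (inj₂ (inj₁ (⊛-cancelˡ 1 position)))
border₀-points {_ , y} (barycentric 0 1 _ refl position) = ⊥-elim (indivisible 2 y 1 (cong proj₂ position))
border₀-points (barycentric 0 2 _ refl position) = inj₂ (inj₁ (⊛-cancelˡ 1 position))
border₀-points (barycentric 0 (ℕ.suc (ℕ.suc (ℕ.suc _))) _ () _)
border₀-points {_ , y} (barycentric 1 0 _ refl position) = ⊥-elim (indivisible 2 y 1 (cong proj₂ position))
border₀-points (barycentric 1 1 _ refl position) = inj₂ (inj₂ (inj₂ (⊛-cancelˡ 1 position)))
border₀-points (barycentric 1 (ℕ.suc (ℕ.suc _)) _ () _)
border₀-points (barycentric 2 0 _ refl position) = inj₁ (⊛-cancelˡ 1 position)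
border₀-points (barycentric 2 (ℕ.suc _) _ () _)
border₀-points (barycentric (ℕ.suc (ℕ.suc (ℕ.suc _))) _ _ () _)

border₀ : Border a₀ b₀ c₀ d₀
border₀ = ((λ ()) , (+≤+ ℕ.z≤n , +≤+ ℕ.z≤n , +≤+ ℕ.z≤n) , (λ ()) , (λ ()) , (λ ()) ,
           λ p p∈ → border₀-points (hull-barycentric refl p∈)) ,
          λ { (+<+ () , _) }

a₁ b₁ c₁ d₁ : Point
a₁ = (+ 0 , + 0)
b₁ = (+ 2 , + 1)
c₁ = (+ 1 , + 2)
d₁ = (+ 1 , + 1)

internal₀-points : ∀ {p} → Barycentric a₁ b₁ c₁ p 3 → (p ≡ a₁) ⊎ (p ≡ b₁) ⊎ (p ≡ c₁) ⊎ (p ≡ d₁)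
internal₀-points (barycentric 0 0 _ refl position) = inj₂ (inj₂ (inj₁ (⊛-cancelˡ 2 position)))
internal₀-points {x , _} (barycentric 0 1 _ refl position) = ⊥-elim (indivisible 3 x 4 (cong proj₁ position))
internal₀-points {x , _} (barycentric 0 2 _ refl position) = ⊥-elim (indivisible 3 x 5 (cong proj₁ position))
internal₀-points (barycentric 0 3 _ refl position) = inj₂ (inj₁ (⊛-cancelˡ 2 position))
internal₀-points (barycentric 0 (ℕ.suc (ℕ.suc (ℕ.suc (ℕ.suc _)))) _ () _)
internal₀-points {x , _} (barycentric 1 0 _ refl position) = ⊥-elim (indivisible 3 x 2 (cong proj₁ position))
internal₀-points (barycentric 1 1 _ refl position) = inj₂ (inj₂ (inj₂ (⊛-cancelˡ 2 position)))
internal₀-points {x , _} (barycentric 1 2 _ refl position) = ⊥-elim (indivisible 3 x 4 (cong proj₁ position))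
internal₀-points (barycentric 1 (ℕ.suc (ℕ.suc (ℕ.suc _))) _ () _)
internal₀-points {x , _} (barycentric 2 0 _ refl position) = ⊥-elim (indivisible 3 x 1 (cong proj₁ position))
internal₀-points {x , _} (barycentric 2 1 _ refl position) = ⊥-elim (indivisible 3 x 2 (cong proj₁ position))
internal₀-points (barycentric 2 (ℕ.suc (ℕ.suc _)) _ () _)
internal₀-points (barycentric 3 0 _ refl position) = inj₁ (⊛-cancelˡ 2 position)
internal₀-points (barycentric 3 (ℕ.suc _) _ () _)
internal₀-points (barycentric (ℕ.suc (ℕ.suc (ℕ.suc (ℕ.suc _)))) _ _ () _)

internal₀ : Internal a₁ b₁ c₁ d₁
internal₀ = ((λ ()) , (+≤+ ℕ.z≤n , +≤+ ℕ.z≤n , +≤+ ℕ.z≤n) , (λ ()) , (λ ()) , (λ ()) ,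
             λ p p∈ → internal₀-points (hull-barycentric refl p∈)) ,
            (+<+ (ℕ.s≤s ℕ.z≤n) , +<+ (ℕ.s≤s ℕ.z≤n) , +<+ (ℕ.s≤s ℕ.z≤n))

-- Symmetries of S29 and spreading through residue classes

-- These maps fix x modulo 3 whenever 3 ∣ y.
shear : ℤ → ℤ → Point → Affine
shear m ε (s , t) = affine 1ℤ m 0ℤ ε (+ 3 * s) (+ 3 * t)

S29-shear : ∀ m ε c → S29 ⊆ (S29 ∘ apply (shear m ε c))
S29-shear m ε (s , t) (x , y) (3∣x? , 3∣y) =
  Sum.map column₀ column₁ 3∣x? ,
  unsigned (sum₃ (Signed.∣m⇒∣m*n x (Signed.divides 0ℤ refl)) (Signed.∣n⇒∣m*n ε {y} (signed 3∣y)) (triple t))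
  where
  signed : ∀ {z} → + 3 ∣ z → + 3 Signed.∣ z
  signed {z} = Signed.∣ᵤ⇒∣ {i = z}
  unsigned : ∀ {z} → + 3 Signed.∣ z → + 3 ∣ z
  unsigned {z} = Signed.∣⇒∣ᵤ {i = z}
  triple : ∀ z → + 3 Signed.∣ + 3 * z
  triple z = Signed.∣m⇒∣m*n z Signed.∣-refl
  sum₃ : ∀ {i j k} → + 3 Signed.∣ i → + 3 Signed.∣ j → + 3 Signed.∣ k → + 3 Signed.∣ i + j + k
  sum₃ {i} {j} {k} hi hj hk = Signed.∣m∣n⇒∣m+n {m = i + j} {n = k} (Signed.∣m∣n⇒∣m+n {m = i} {n = j} hi hj) hk
  column : ∀ u → + 3 ∣ u → + 3 Signed.∣ 1ℤ * u + m * y + + 3 * s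
  column u 3∣u = sum₃ (Signed.∣n⇒∣m*n 1ℤ {u} (signed 3∣u)) (Signed.∣n⇒∣m*n m {y} (signed 3∣y)) (triple s)
  shifted : ∀ x m y s → 1ℤ * (x - + 1) + m * y + + 3 * s ≡ (1ℤ * x + m * y + + 3 * s) - + 1
  shifted = solve-∀
  column₀ : + 3 ∣ x → + 3 ∣ (1ℤ * x + m * y + + 3 * s)
  column₀ 3∣x = unsigned (column x 3∣x)
  column₁ : + 3 ∣ (x - + 1) → + 3 ∣ ((1ℤ * x + m * y + + 3 * s) - + 1)
  column₁ 3∣x-1 = unsigned (subst (+ 3 Signed.∣_) (shifted x m y s) (column (x - + 1) 3∣x-1))

shear-unimodular : ∀ m ε c → ε * ε ≡ 1ℤ → Unimodular (shear m ε c)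
shear-unimodular m ε c ε²≡1 = unimodular (trans (identity m ε) ε²≡1)
  where
  identity : ∀ m ε → (1ℤ * ε - m * 0ℤ) * (1ℤ * ε - m * 0ℤ) ≡ ε * ε
  identity = solve-∀

Generates : (Subset → Set) → Point → Set₁
Generates St r = ∀ S → St S → S29 ⊆ S → S r → ¬ Proper S

generates-apply : ∀ {St φ r} → PullbackClosed St → Unimodular φ → S29 ⊆ (S29 ∘ apply φ) →
  Generates St r → Generates St (apply φ r)
generates-apply {φ = φ} closed u symmetry generates S stable S29⊆S Sφr (q , q∉S) =
  generates (S ∘ apply φ) (closed u stable) (λ p → S29⊆S (apply φ p) ∘ symmetry p) Sφr
    (unapply φ q , q∉S ∘ subst S (apply-unapply u q))

translate₃ : Point → Affine
translate₃ = shear 0ℤ 1ℤ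

apply-translate₃ : ∀ c p → apply (translate₃ c) p ≡ p ⊕ + 3 ⊛ c
apply-translate₃ (s , t) (x , y) = cong₂ _,_ (first x y s) (second x y t)
  where
  first : ∀ x y s → 1ℤ * x + 0ℤ * y + + 3 * s ≡ x + + 3 * s
  first = solve-∀
  second : ∀ x y t → 0ℤ * x + 1ℤ * y + + 3 * t ≡ y + + 3 * t
  second = solve-∀

directions : List Point
directions = (1ℤ , 0ℤ) ∷ (-1ℤ , 0ℤ) ∷ (0ℤ , 1ℤ) ∷ (0ℤ , -1ℤ) ∷ []

block : List Point
block = cartesianProductWith (λ i j → (+ i , + j)) (upTo 3) (upTo 3)

neighbours : Point → List Point
neighbours r = map (λ e → r ⊕ + 3 ⊛ e) directions

targets : Point → List Point
targets r = neighbours r ++ block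

ℤ-induction : (P : ℤ → Set) → P 0ℤ → (∀ k → P k → P (k + 1ℤ)) → (∀ k → P k → P (k + -1ℤ)) → ∀ k → P k
ℤ-induction P p₀ up down (+ ℕ.zero) = p₀
ℤ-induction P p₀ up down (+ ℕ.suc n) =
  subst P (cong +_ (ℕ.+-comm n 1)) (up (+ n) (ℤ-induction P p₀ up down (+ n)))
ℤ-induction P p₀ up down -[1+ ℕ.zero ] = down 0ℤ p₀
ℤ-induction P p₀ up down -[1+ ℕ.suc n ] =
  subst P (cong (λ m → -[1+ ℕ.suc m ]) (ℕ.+-identityʳ n)) (down -[1+ n ] (ℤ-induction P p₀ up down -[1+ n ]))

ℤ²-induction : (P : Point → Set) → P (0ℤ , 0ℤ) → (∀ c {e} → e ∈ directions → P c → P (c ⊕ e)) → ∀ c → P c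
ℤ²-induction P p₀ step (x , y) =
  ℤ-induction (λ x → P (x , y)) column (horizontal (here refl)) (horizontal (there (here refl))) x
  where
  horizontal : ∀ {δ} → (δ , 0ℤ) ∈ directions → ∀ x → P (x , y) → P (x + δ , y)
  horizontal e∈ x = subst P (cong (_ ,_) (+-identityʳ y)) ∘ step (x , y) e∈
  vertical : ∀ {δ} → (0ℤ , δ) ∈ directions → ∀ y → P (0ℤ , y) → P (0ℤ , y + δ)
  vertical e∈ y = step (0ℤ , y) e∈
  column : P (0ℤ , y)
  column = ℤ-induction (λ y → P (0ℤ , y)) p₀ (vertical (there (there (here refl)))) (vertical (there (there (there (here refl))))) y

residue₃ quotient₃ : Point → Point
residue₃ (x , y) = (+ (x %ℕ 3) , + (y %ℕ 3))
quotient₃ (x , y) = (x /ℕ 3 , y /ℕ 3)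

residue₃∈block : ∀ q → residue₃ q ∈ block
residue₃∈block (x , y) = ∈-cartesianProductWith⁺ (λ i j → (+ i , + j)) (∈-upTo⁺ (n%ℕd<d x 3)) (∈-upTo⁺ (n%ℕd<d y 3))

residue-decomposition : ∀ q → apply (translate₃ (quotient₃ q)) (residue₃ q) ≡ q
residue-decomposition q@(x , y) = trans (apply-translate₃ (quotient₃ q) (residue₃ q)) (cong₂ _,_ (recompose x) (recompose y))
  where
  recompose : ∀ z → + (z %ℕ 3) + + 3 * (z /ℕ 3) ≡ z
  recompose z = sym (trans (a≡a%ℕn+[a/ℕn]*n z 3) (cong (λ e → + (z %ℕ 3) + e) (*-comm (z /ℕ 3) (+ 3))))

Spreads : (Subset → Set) → Point → Set₁
Spreads St r = ∀ S → St S → S29 ⊆ S → S r → ¬ ¬ All S (targets r)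

spreads⇒generates : ∀ {St r} → PullbackClosed St → Spreads St r → Generates St r
spreads⇒generates {St} {r} closed spreads S stable S29⊆S Sr (q , q∉S) = covered q q∉S
  where
  moved : ∀ c → ¬ ¬ S (r ⊕ + 3 ⊛ c) → ¬ ¬ All (S ∘ apply (translate₃ c)) (targets r)
  moved c Sr+3c = Sr+3c >>= λ h →
    spreads (S ∘ apply (translate₃ c)) (closed (shear-unimodular 0ℤ 1ℤ c refl) stable)
      (λ p → S29⊆S _ ∘ S29-shear 0ℤ 1ℤ c p) (subst S (sym (apply-translate₃ c r)) h)
  neighbour : ∀ c e → apply (translate₃ c) (r ⊕ + 3 ⊛ e) ≡ r ⊕ + 3 ⊛ (c ⊕ e)
  neighbour c@(cx , cy) e@(ex , ey) =
    trans (apply-translate₃ c (r ⊕ + 3 ⊛ e)) (cong₂ _,_ (regroup (proj₁ r) ex cx) (regroup (proj₂ r) ey cy))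
    where
    regroup : ∀ r e c → r + + 3 * e + + 3 * c ≡ r + + 3 * (c + e)
    regroup = solve-∀
  lattice : ∀ c → ¬ ¬ S (r ⊕ + 3 ⊛ c)
  lattice = ℤ²-induction (λ c → ¬ ¬ S (r ⊕ + 3 ⊛ c)) (pure (subst S (sym (⊕-identityʳ r)) Sr)) λ c {e} e∈ h → do
    found ← moved c h
    pure (subst S (neighbour c e) (All.lookup (All.map⁻ {f = λ e → r ⊕ + 3 ⊛ e} (All.++⁻ˡ (neighbours r) found)) e∈))
  covered : ∀ q → ¬ ¬ S q
  covered q = do
    found ← moved (quotient₃ q) (lattice (quotient₃ q))
    pure (subst S (residue-decomposition q) (All.lookup (All.++⁻ʳ (neighbours r) found) (residue₃∈block q)))

-- Certificates

S29? : ∀ p → Dec (S29 p)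
S29? p = ((3 ℕ.∣? ∣ proj₁ p ∣) ⊎-dec (3 ℕ.∣? ∣ proj₁ p - + 1 ∣)) ×-dec (3 ℕ.∣? ∣ proj₂ p ∣)

others : Fin 4 → List (Fin 4)
others 0F = 1F ∷ 2F ∷ 3F ∷ []
others 1F = 0F ∷ 2F ∷ 3F ∷ []
others 2F = 0F ∷ 1F ∷ 3F ∷ []
others 3F = 0F ∷ 1F ∷ 2F ∷ []

fourth : ∀ {S} (v : Fin 4 → Point) → ¬ ExactlyThree S (v 0F) (v 1F) (v 2F) (v 3F) →
  ∀ k → All (S ∘ v) (others k) → ¬ ¬ S (v k)
fourth v avoid 0F (s₁ ∷ s₂ ∷ s₃ ∷ []) ¬s₀ = avoid (inj₁ (¬s₀ , s₁ , s₂ , s₃))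
fourth v avoid 1F (s₀ ∷ s₂ ∷ s₃ ∷ []) ¬s₁ = avoid (inj₂ (inj₁ (s₀ , ¬s₁ , s₂ , s₃)))
fourth v avoid 2F (s₀ ∷ s₁ ∷ s₃ ∷ []) ¬s₂ = avoid (inj₂ (inj₂ (inj₁ (s₀ , s₁ , ¬s₂ , s₃))))
fourth v avoid 3F (s₀ ∷ s₁ ∷ s₂ ∷ []) ¬s₃ = avoid (inj₂ (inj₂ (inj₂ (s₀ , s₁ , s₂ , ¬s₃))))

-- A step uses the image of the template triangle under `transform`: three of its points are already known
-- to lie in S, so stability puts the corner `conclusion` in S as well.
record Step : Set where
  constructor infer
  field
    conclusion : Fin 4
    transform : Affine

module Certificate (template : Fin 4 → Point) where

  Avoids : Subset → Set
  Avoids S = ∀ {φ} → Unimodular φ →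
    ¬ ExactlyThree S (apply φ (template 0F)) (apply φ (template 1F)) (apply φ (template 2F)) (apply φ (template 3F))

  available : List Point → Point → Bool
  available known p = isYes (S29? p) ∨ isYes (p ∈? known)

  derived : Step → Point
  derived (infer k φ) = apply φ (template k)

  valid : List Point → Step → Bool
  valid known (infer k φ) = isYes (det φ * det φ ≟ 1ℤ) ∧ all (available known ∘ apply φ ∘ template) (others k)

  closure : List Point → List Step → List Point
  closure known [] = known
  closure known (s ∷ steps) = closure (derived s ∷ known) steps

  all-valid : List Point → List Step → Bool
  all-valid known [] = true
  all-valid known (s ∷ steps) = valid known s ∧ all-valid (derived s ∷ known) steps

  Proves : Point → List Step → Set
  Proves r steps = T (all-valid (r ∷ []) steps ∧ all (available (closure (r ∷ []) steps)) (targets r))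

  module _ {S : Subset} (avoids : Avoids S) (S29⊆S : S29 ⊆ S) where

    available-sound : ∀ {known p} → All S known → T (available known p) → S p
    available-sound {known} {p} S-known ok with Equivalence.to (T-∨ {isYes (S29? p)}) ok
    ... | inj₁ in-S29 = S29⊆S p (toWitness {a? = S29? p} in-S29)
    ... | inj₂ is-known = All.lookup S-known (toWitness {a? = p ∈? known} is-known)

    valid-sound : ∀ {known} → All S known → ∀ s → T (valid known s) → ¬ ¬ S (derived s)
    valid-sound S-known (infer k φ) ok =
      fourth {S} (apply φ ∘ template) (avoids {φ} (unimodular (toWitness {a? = det φ * det φ ≟ 1ℤ} det-ok))) k
        (All.map (available-sound S-known) (All.all⁺ _ (others k) others-ok))
      where
      det-ok = proj₁ (Equivalence.to (T-∧ {isYes (det φ * det φ ≟ 1ℤ)}) ok)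
      others-ok = proj₂ (Equivalence.to (T-∧ {isYes (det φ * det φ ≟ 1ℤ)}) ok)

    closure-sound : ∀ {known} → All S known → ∀ steps → T (all-valid known steps) → ¬ ¬ All S (closure known steps)
    closure-sound S-known [] _ = pure S-known
    closure-sound S-known (s ∷ steps) ok = do
      new ← valid-sound S-known s (proj₁ (Equivalence.to T-∧ ok))
      closure-sound (new ∷ S-known) steps (proj₂ (Equivalence.to (T-∧ {valid _ s}) ok))

    proves-sound : ∀ {r} steps → Proves r steps → S r → ¬ ¬ All S (targets r)
    proves-sound {r} steps ok Sr = do
      S-closure ← closure-sound (Sr ∷ []) steps (proj₁ (Equivalence.to T-∧ ok))
      pure (All.map (available-sound S-closure) (All.all⁺ _ (targets r) (proj₂ (Equivalence.to (T-∧ {all-valid _ steps}) ok))))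

certified-spreads : ∀ {St} template → (∀ {S} → St S → Certificate.Avoids template S) →
  ∀ r steps → Certificate.Proves template r steps → Spreads St r
certified-spreads template avoids r steps ok S stable S29⊆S = Certificate.proves-sound template (avoids stable) S29⊆S steps ok

BStable-avoids : ∀ {S} → BStable S → Certificate.Avoids (corners a₀ b₀ c₀ d₀) S
BStable-avoids stable u = BStable-pullback u stable a₀ b₀ c₀ d₀ border₀

IStable-avoids : ∀ {S} → IStable S → Certificate.Avoids (corners a₁ b₁ c₁ d₁) S
IStable-avoids stable u = IStable-pullback u stable a₁ b₁ c₁ d₁ internal₀

border-steps₂₀ : List Step
border-steps₂₀ =
    infer 2F (affine (- + 1) (+ 1) (+ 0) (- + 1) (+ 2) (+ 0))
  ∷ infer 2F (affine (- + 1) (+ 2) (+ 0) (- + 1) (+ 3) (+ 0))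
  ∷ infer 2F (affine (- + 1) (+ 2) (+ 0) (- + 1) (+ 2) (+ 0))
  ∷ infer 2F (affine (+ 1) (+ 2) (+ 0) (+ 1) (+ 3) (- + 1))
  ∷ infer 2F (affine (+ 1) (- + 2) (+ 0) (+ 1) (+ 0) (+ 0))
  ∷ infer 1F (affine (+ 1) (+ 1) (+ 0) (+ 1) (- + 3) (+ 0))
  ∷ infer 2F (affine (- + 1) (- + 2) (+ 0) (- + 1) (+ 2) (+ 0))
  ∷ infer 2F (affine (+ 1) (+ 1) (+ 0) (+ 1) (+ 0) (+ 0))
  ∷ infer 1F (affine (+ 1) (+ 0) (+ 2) (+ 1) (+ 0) (- + 1))
  ∷ infer 2F (affine (+ 1) (+ 0) (+ 0) (+ 1) (+ 0) (+ 0))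
  ∷ infer 2F (affine (- + 1) (- + 1) (+ 0) (- + 1) (+ 2) (+ 0))
  ∷ infer 1F (affine (+ 1) (+ 1) (- + 2) (- + 1) (+ 0) (+ 1))
  ∷ infer 2F (affine (+ 1) (- + 1) (+ 0) (+ 1) (+ 0) (+ 0))
  ∷ infer 1F (affine (+ 1) (- + 1) (+ 1) (+ 0) (- + 2) (+ 0))
  ∷ infer 1F (affine (+ 2) (+ 1) (+ 1) (+ 1) (- + 3) (+ 0))
  ∷ infer 2F (affine (+ 1) (+ 2) (+ 0) (+ 1) (+ 0) (+ 0))
  ∷ infer 1F (affine (+ 2) (- + 1) (+ 1) (+ 0) (- + 2) (+ 0))
  ∷ []

border-steps₀₁ : List Step
border-steps₀₁ =
    infer 3F (affine (- + 1) (+ 0) (- + 2) (- + 1) (+ 0) (+ 1))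
  ∷ infer 1F (affine (+ 2) (+ 1) (+ 1) (+ 1) (- + 1) (- + 1))
  ∷ infer 3F (affine (- + 1) (+ 0) (+ 1) (- + 1) (+ 0) (+ 1))
  ∷ infer 3F (affine (+ 2) (- + 1) (+ 1) (+ 0) (- + 5) (+ 0))
  ∷ infer 0F (affine (- + 1) (+ 1) (- + 2) (+ 1) (+ 2) (+ 5))
  ∷ infer 3F (affine (+ 2) (- + 1) (+ 1) (+ 0) (- + 2) (+ 3))
  ∷ infer 0F (affine (- + 1) (- + 2) (+ 1) (+ 1) (+ 2) (- + 1))
  ∷ infer 3F (affine (+ 2) (- + 1) (+ 1) (+ 0) (- + 2) (- + 3))
  ∷ infer 0F (affine (+ 0) (+ 1) (- + 1) (- + 2) (+ 0) (+ 2))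
  ∷ infer 1F (affine (+ 2) (+ 1) (- + 1) (+ 0) (- + 3) (+ 3))
  ∷ infer 3F (affine (+ 1) (+ 2) (+ 0) (+ 1) (- + 2) (+ 0))
  ∷ infer 1F (affine (+ 1) (- + 1) (+ 1) (+ 0) (- + 1) (+ 0))
  ∷ infer 1F (affine (+ 1) (+ 0) (+ 0) (+ 1) (+ 0) (+ 0))
  ∷ infer 1F (affine (+ 0) (+ 1) (- + 1) (- + 1) (+ 0) (+ 1))
  ∷ infer 1F (affine (+ 1) (- + 1) (+ 1) (+ 0) (+ 0) (- + 1))
  ∷ infer 1F (affine (+ 2) (- + 1) (+ 1) (+ 0) (- + 2) (+ 0))
  ∷ []

internal-steps₂₀ : List Step
internal-steps₂₀ =
    infer 3F (affine (+ 1) (+ 0) (- + 2) (+ 1) (+ 2) (+ 0))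
  ∷ infer 1F (affine (+ 2) (+ 1) (+ 1) (+ 1) (+ 0) (- + 3))
  ∷ infer 3F (affine (+ 2) (+ 1) (+ 1) (+ 1) (- + 3) (- + 3))
  ∷ infer 3F (affine (+ 1) (+ 2) (- + 1) (- + 1) (- + 2) (+ 3))
  ∷ infer 0F (affine (+ 0) (+ 1) (- + 1) (+ 1) (- + 1) (+ 0))
  ∷ infer 3F (affine (+ 1) (+ 0) (- + 2) (+ 1) (+ 0) (+ 3))
  ∷ infer 2F (affine (+ 2) (+ 1) (+ 1) (+ 1) (- + 2) (+ 0))
  ∷ infer 3F (affine (+ 0) (+ 1) (- + 1) (+ 2) (+ 0) (- + 3))
  ∷ infer 1F (affine (+ 1) (+ 2) (- + 1) (- + 1) (- + 2) (+ 0))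
  ∷ infer 3F (affine (+ 1) (+ 2) (- + 1) (- + 1) (- + 3) (+ 3))
  ∷ infer 3F (affine (- + 1) (- + 2) (+ 1) (+ 1) (+ 2) (+ 0))
  ∷ infer 2F (affine (+ 1) (+ 1) (- + 1) (+ 0) (- + 3) (+ 3))
  ∷ infer 3F (affine (+ 0) (+ 1) (- + 1) (+ 2) (+ 1) (+ 0))
  ∷ infer 2F (affine (+ 1) (+ 2) (+ 0) (+ 1) (- + 3) (+ 0))
  ∷ []

internal-steps₀₁ : List Step
internal-steps₀₁ =
    infer 2F (affine (+ 1) (+ 2) (- + 1) (- + 1) (- + 3) (+ 3))
  ∷ infer 3F (affine (+ 0) (+ 1) (- + 1) (+ 2) (+ 2) (+ 0))
  ∷ infer 0F (affine (+ 0) (+ 1) (- + 1) (+ 2) (- + 1) (+ 0))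
  ∷ infer 3F (affine (+ 1) (+ 2) (- + 1) (- + 1) (- + 6) (+ 3))
  ∷ infer 0F (affine (+ 2) (- + 1) (+ 1) (+ 0) (- + 3) (- + 1))
  ∷ infer 2F (affine (+ 0) (- + 1) (+ 1) (+ 2) (+ 1) (- + 3))
  ∷ infer 2F (affine (+ 1) (+ 1) (+ 1) (+ 2) (- + 3) (- + 1))
  ∷ infer 0F (affine (+ 1) (+ 0) (+ 0) (+ 1) (- + 1) (- + 1))
  ∷ infer 2F (affine (+ 0) (+ 1) (- + 1) (- + 2) (- + 2) (+ 3))
  ∷ infer 1F (affine (- + 1) (- + 1) (+ 2) (+ 1) (+ 3) (- + 3))
  ∷ infer 3F (affine (+ 1) (+ 2) (- + 1) (- + 1) (- + 2) (+ 3))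
  ∷ infer 1F (affine (+ 1) (+ 0) (+ 1) (+ 1) (- + 1) (- + 1))
  ∷ infer 2F (affine (+ 1) (+ 2) (+ 0) (+ 1) (- + 3) (- + 1))
  ∷ infer 3F (affine (+ 2) (+ 1) (+ 1) (+ 1) (- + 1) (+ 0))
  ∷ []


BStable-generates₂₀ : Generates BStable (+ 2 , + 0)
BStable-generates₂₀ =
  spreads⇒generates BStable-pullback (certified-spreads (corners a₀ b₀ c₀ d₀) BStable-avoids (+ 2 , + 0) border-steps₂₀ _)

BStable-generates₀₁ : Generates BStable (+ 0 , + 1)
BStable-generates₀₁ =
  spreads⇒generates BStable-pullback (certified-spreads (corners a₀ b₀ c₀ d₀) BStable-avoids (+ 0 , + 1) border-steps₀₁ _)

IStable-generates₂₀ : Generates IStable (+ 2 , + 0)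
IStable-generates₂₀ =
  spreads⇒generates IStable-pullback (certified-spreads (corners a₁ b₁ c₁ d₁) IStable-avoids (+ 2 , + 0) internal-steps₂₀ _)

IStable-generates₀₁ : Generates IStable (+ 0 , + 1)
IStable-generates₀₁ =
  spreads⇒generates IStable-pullback (certified-spreads (corners a₁ b₁ c₁ d₁) IStable-avoids (+ 0 , + 1) internal-steps₀₁ _)

-- Maximality

S29-proper : Proper S29
S29-proper = (+ 0 , + 1) , λ p∈ → toWitnessFalse {a? = 3 ℕ.∣? 1} _ (proj₂ p∈)

module _ {St : Subset → Set} (closed : PullbackClosed St) where

  generates-shear : ∀ {r} m ε c → ε * ε ≡ 1ℤ → Generates St r → Generates St (apply (shear m ε c) r)
  generates-shear m ε c ε²≡1 = generates-apply closed (shear-unimodular m ε c ε²≡1) (S29-shear m ε c)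

  generates-residue : Generates St (+ 2 , + 0) → Generates St (+ 0 , + 1) →
    ∀ i j → i ℕ.< 3 → j ℕ.< 3 → ¬ S29 (+ i , + j) → Generates St (+ i , + j)
  generates-residue g₂₀ g₀₁ 0 0 _ _ ∉ = ⊥-elim (∉ (inj₁ (ℕ.divides 0 refl) , ℕ.divides 0 refl))
  generates-residue g₂₀ g₀₁ 1 0 _ _ ∉ = ⊥-elim (∉ (inj₂ (ℕ.divides 0 refl) , ℕ.divides 0 refl))
  generates-residue g₂₀ g₀₁ 2 0 _ _ _ = g₂₀
  generates-residue g₂₀ g₀₁ 0 1 _ _ _ = g₀₁
  generates-residue g₂₀ g₀₁ 1 1 _ _ _ = generates-shear (+ 1) 1ℤ (0ℤ , 0ℤ) refl g₀₁
  generates-residue g₂₀ g₀₁ 2 1 _ _ _ = generates-shear (+ 2) 1ℤ (0ℤ , 0ℤ) refl g₀₁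
  generates-residue g₂₀ g₀₁ 0 2 _ _ _ = generates-shear (+ 0) -1ℤ (0ℤ , 1ℤ) refl g₀₁
  generates-residue g₂₀ g₀₁ 1 2 _ _ _ = generates-shear (+ 1) -1ℤ (0ℤ , 1ℤ) refl g₀₁
  generates-residue g₂₀ g₀₁ 2 2 _ _ _ = generates-shear (+ 2) -1ℤ (0ℤ , 1ℤ) refl g₀₁
  generates-residue g₂₀ g₀₁ (ℕ.suc (ℕ.suc (ℕ.suc _))) _ (ℕ.s≤s (ℕ.s≤s (ℕ.s≤s ()))) _ _
  generates-residue g₂₀ g₀₁ _ (ℕ.suc (ℕ.suc (ℕ.suc _))) _ (ℕ.s≤s (ℕ.s≤s (ℕ.s≤s ()))) _

  generates-outside : Generates St (+ 2 , + 0) → Generates St (+ 0 , + 1) → ∀ p → ¬ S29 p → Generates St p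
  generates-outside g₂₀ g₀₁ p@(x , y) p∉S29 =
    subst (Generates St) (residue-decomposition p)
      (generates-shear 0ℤ 1ℤ (quotient₃ p) refl
        (generates-residue g₂₀ g₀₁ (x %ℕ 3) (y %ℕ 3) (n%ℕd<d x 3) (n%ℕd<d y 3)
          (λ r∈S29 → p∉S29 (subst S29 (residue-decomposition p) (S29-shear 0ℤ 1ℤ (quotient₃ p) (residue₃ p) r∈S29)))))

  maximal : St S29 → Generates St (+ 2 , + 0) → Generates St (+ 0 , + 1) → Maximal St S29
  maximal stable g₂₀ g₀₁ = stable , S29-proper , λ S′ stable′ proper′ S29⊆S′ (p , S′p , p∉S29) →
    generates-outside g₂₀ g₀₁ p p∉S29 S′ stable′ S29⊆S′ S′p proper′

BIStable-generates : ∀ {r} → Generates BStable r → Generates BIStable r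
BIStable-generates generates S (b-stable , _) = generates S b-stable

proposition5p2 : Maximal BStable S29 × Maximal IStable S29 × Maximal BIStable S29
proposition5p2 =
  maximal BStable-pullback S29-BStable BStable-generates₂₀ BStable-generates₀₁ ,
  maximal IStable-pullback S29-IStable IStable-generates₂₀ IStable-generates₀₁ ,
  maximal BIStable-pullback (S29-BStable , S29-IStable)
    (BIStable-generates BStable-generates₂₀) (BIStable-generates BStable-generates₀₁)
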